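{- If $(G,k_v,k_e,C,\delta,w,c)$ is a normalized yes-instance of DPGGD (respectively of DCPGGD), then $G$ has a $2$-dominating set of size at most $k_v+2k_e$.
   Context: All graphs are finite, undirected, simple; $d_G(v)$ is the degree of $v$. For a function $f$ and a set $A$, $f(A)=\sum_{a\in A}f(a)$. An instance of DPGGD is $(G,k_v,k_e,C,\delta,w,c)$ where $G=(V,E)$ is planar, $k_v,k_e,C$ are integers, $\delta\colon V\to\mathbb{N}_0$, $w\colon V\cup E\to\mathbb{N}$ (positive integers), $c\colon V\cup E\to\mathbb{N}_0$. A solution is a pair $(U,D)$, $U\subseteq V$, $D\subseteq E$, with $w(U)\le k_v$, $w(D)\le k_e$, $c(U\cup D)\le C$ and $d_{G'}(v)=\delta(v)$ for all $v\in V(G')$ where $G'=G-U-D$; it is a yes-instance if a solution exists. DCPGGD is the same problem but a solution additionally requires $G'$ to be connected. An instance is normalized if (i) $\delta(v)\le d_G(v)\le \delta(v)+k_v+k_e$ for every $v\in V(G)$, and (ii) every vertex of $S=\{u\in V(G): d_G(u)=\delta(u)\}$ is adjacent to a vertex of $V(G)\setminus S$. A set $X\subseteq V(G)$ is $2$-dominating if every vertex of $G$ is at distance at most $2$ from some vertex of $X$. -}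

module Defs where

open import Data.Nat as ℕ using (ℕ; zero; suc)
open import Data.Integer as ℤ using (ℤ; +_)
open import Data.Fin using (Fin; zero; suc; toℕ; _<?_; _≟_)
open import Data.Fin.Subset using (Subset; _∈_; _∉_; ∣_∣)
open import Data.Vec using (lookup)
open import Data.Bool using (Bool; true; false; if_then_else_; _∧_; not; _xor_)
open import Data.Product using (Σ; ∃; _×_; _,_)
open import Data.Sum using (_⊎_)
open import Relation.Nullary using (¬_; ⌊_⌋)
open import Relation.Binary.PropositionalEquality using (_≡_; _≢_; refl)

sumFin : (n : ℕ) → (Fin n → ℕ) → ℕ
sumFin zero    f = 0
sumFin (suc n) f = f zero ℕ.+ sumFin n (λ i → f (suc i))

record Graph (n : ℕ) : Set where
  field
    adj    : Fin n → Fin n → Bool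
    sym    : ∀ i j → adj i j ≡ adj j i
    irrefl : ∀ i → adj i i ≡ false
open Graph public

Adj : ∀ {n} → Graph n → Fin n → Fin n → Set
Adj G i j = adj G i j ≡ true

deg : ∀ {n} → Graph n → Fin n → ℕ
deg {n} G v = sumFin n (λ j → if adj G v j then 1 else 0)

inU : ∀ {n} → Subset n → Fin n → Bool
inU U i = lookup U i

-- Planarity (Wagner's combinatorial characterization: no K5 and no K3,3
-- minor).

data WalkIn {n} (G : Graph n) (S : Fin n → Bool) : Fin n → Fin n → Set where
  here : ∀ {u} → S u ≡ true → WalkIn G S u u
  step : ∀ {u m v} → S u ≡ true → Adj G u m → WalkIn G S m v → WalkIn G S u v

record Minor {m n} (H : Graph m) (G : Graph n) : Set where
  field
    branch    : Fin m → Fin n → Bool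
    nonempty  : ∀ a → ∃ λ u → branch a u ≡ true
    disjoint  : ∀ a b u → a ≢ b → branch a u ≡ true → branch b u ≡ false
    connected : ∀ a u v → branch a u ≡ true → branch a v ≡ true →
                WalkIn G (branch a) u v
    edges     : ∀ a b → Adj H a b →
                ∃ λ u → ∃ λ v → branch a u ≡ true × branch b v ≡ true × Adj G u v

neqFin : ∀ {k} → Fin k → Fin k → Bool
neqFin i j = not ⌊ i ≟ j ⌋

adjK5 : Fin 5 → Fin 5 → Bool
adjK5 i j = neqFin i j

symK5 : ∀ i j → adjK5 i j ≡ adjK5 j i
symK5 zero zero = refl
symK5 zero (suc zero) = refl
symK5 zero (suc (suc zero)) = refl
symK5 zero (suc (suc (suc zero))) = refl
symK5 zero (suc (suc (suc (suc zero)))) = refl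
symK5 (suc zero) zero = refl
symK5 (suc zero) (suc zero) = refl
symK5 (suc zero) (suc (suc zero)) = refl
symK5 (suc zero) (suc (suc (suc zero))) = refl
symK5 (suc zero) (suc (suc (suc (suc zero)))) = refl
symK5 (suc (suc zero)) zero = refl
symK5 (suc (suc zero)) (suc zero) = refl
symK5 (suc (suc zero)) (suc (suc zero)) = refl
symK5 (suc (suc zero)) (suc (suc (suc zero))) = refl
symK5 (suc (suc zero)) (suc (suc (suc (suc zero)))) = refl
symK5 (suc (suc (suc zero))) zero = refl
symK5 (suc (suc (suc zero))) (suc zero) = refl
symK5 (suc (suc (suc zero))) (suc (suc zero)) = refl
symK5 (suc (suc (suc zero))) (suc (suc (suc zero))) = refl
symK5 (suc (suc (suc zero))) (suc (suc (suc (suc zero)))) = refl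
symK5 (suc (suc (suc (suc zero)))) zero = refl
symK5 (suc (suc (suc (suc zero)))) (suc zero) = refl
symK5 (suc (suc (suc (suc zero)))) (suc (suc zero)) = refl
symK5 (suc (suc (suc (suc zero)))) (suc (suc (suc zero))) = refl
symK5 (suc (suc (suc (suc zero)))) (suc (suc (suc (suc zero)))) = refl

irrK5 : ∀ i → adjK5 i i ≡ false
irrK5 zero = refl
irrK5 (suc zero) = refl
irrK5 (suc (suc zero)) = refl
irrK5 (suc (suc (suc zero))) = refl
irrK5 (suc (suc (suc (suc zero)))) = refl

K5 : Graph 5
K5 = record { adj = adjK5 ; sym = symK5 ; irrefl = irrK5 }

adjK33 : Fin 6 → Fin 6 → Bool
adjK33 i j = (toℕ i ℕ.<ᵇ 3) xor (toℕ j ℕ.<ᵇ 3)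

symK33 : ∀ i j → adjK33 i j ≡ adjK33 j i
symK33 zero zero = refl
symK33 zero (suc zero) = refl
symK33 zero (suc (suc zero)) = refl
symK33 zero (suc (suc (suc zero))) = refl
symK33 zero (suc (suc (suc (suc zero)))) = refl
symK33 zero (suc (suc (suc (suc (suc zero))))) = refl
symK33 (suc zero) zero = refl
symK33 (suc zero) (suc zero) = refl
symK33 (suc zero) (suc (suc zero)) = refl
symK33 (suc zero) (suc (suc (suc zero))) = refl
symK33 (suc zero) (suc (suc (suc (suc zero)))) = refl
symK33 (suc zero) (suc (suc (suc (suc (suc zero))))) = refl
symK33 (suc (suc zero)) zero = refl
symK33 (suc (suc zero)) (suc zero) = refl
symK33 (suc (suc zero)) (suc (suc zero)) = refl
symK33 (suc (suc zero)) (suc (suc (suc zero))) = refl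
symK33 (suc (suc zero)) (suc (suc (suc (suc zero)))) = refl
symK33 (suc (suc zero)) (suc (suc (suc (suc (suc zero))))) = refl
symK33 (suc (suc (suc zero))) zero = refl
symK33 (suc (suc (suc zero))) (suc zero) = refl
symK33 (suc (suc (suc zero))) (suc (suc zero)) = refl
symK33 (suc (suc (suc zero))) (suc (suc (suc zero))) = refl
symK33 (suc (suc (suc zero))) (suc (suc (suc (suc zero)))) = refl
symK33 (suc (suc (suc zero))) (suc (suc (suc (suc (suc zero))))) = refl
symK33 (suc (suc (suc (suc zero)))) zero = refl
symK33 (suc (suc (suc (suc zero)))) (suc zero) = refl
symK33 (suc (suc (suc (suc zero)))) (suc (suc zero)) = refl
symK33 (suc (suc (suc (suc zero)))) (suc (suc (suc zero))) = refl
symK33 (suc (suc (suc (suc zero)))) (suc (suc (suc (suc zero)))) = refl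
symK33 (suc (suc (suc (suc zero)))) (suc (suc (suc (suc (suc zero))))) = refl
symK33 (suc (suc (suc (suc (suc zero))))) zero = refl
symK33 (suc (suc (suc (suc (suc zero))))) (suc zero) = refl
symK33 (suc (suc (suc (suc (suc zero))))) (suc (suc zero)) = refl
symK33 (suc (suc (suc (suc (suc zero))))) (suc (suc (suc zero))) = refl
symK33 (suc (suc (suc (suc (suc zero))))) (suc (suc (suc (suc zero)))) = refl
symK33 (suc (suc (suc (suc (suc zero))))) (suc (suc (suc (suc (suc zero))))) = refl

irrK33 : ∀ i → adjK33 i i ≡ false
irrK33 zero = refl
irrK33 (suc zero) = refl
irrK33 (suc (suc zero)) = refl
irrK33 (suc (suc (suc zero))) = refl
irrK33 (suc (suc (suc (suc zero)))) = refl
irrK33 (suc (suc (suc (suc (suc zero))))) = refl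

K33 : Graph 6
K33 = record { adj = adjK33 ; sym = symK33 ; irrefl = irrK33 }

Planar : ∀ {n} → Graph n → Set
Planar G = ¬ Minor K5 G × ¬ Minor K33 G

record Instance : Set where
  field
    n   : ℕ
    G   : Graph n
    planar : Planar G
    kv  : ℤ
    ke  : ℤ
    C   : ℤ
    δ   : Fin n → ℕ
    wv  : Fin n → ℕ
    cv  : Fin n → ℕ
    -- edge weights / costs: the edge {i,j} with i < j gets  we i j  /  ce i j
    we  : Fin n → Fin n → ℕ
    ce  : Fin n → Fin n → ℕ
    wv-pos : ∀ v → 1 ℕ.≤ wv v
    we-pos : ∀ i j → toℕ i ℕ.< toℕ j → Adj G i j → 1 ℕ.≤ we i j
open Instance public

record EdgeSet {n} (G : Graph n) : Set where
  field
    mem    : Fin n → Fin n → Bool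
    symm   : ∀ i j → mem i j ≡ mem j i
    sub    : ∀ i j → mem i j ≡ true → Adj G i j
open EdgeSet public

sumV : ∀ {n} → (Fin n → ℕ) → Subset n → ℕ
sumV {n} f U = sumFin n (λ i → if inU U i then f i else 0)

-- f(D) for an edge set D (each edge {i,j} counted once, via i < j)
sumE : ∀ {n} {G : Graph n} → (Fin n → Fin n → ℕ) → EdgeSet G → ℕ
sumE {n} f D = sumFin n (λ i → sumFin n (λ j →
  if ⌊ i <? j ⌋ ∧ mem D i j then f i j else 0))

adj' : ∀ {n} (G : Graph n) → Subset n → EdgeSet G → Fin n → Fin n → Bool
adj' G U D i j = adj G i j ∧ not (mem D i j) ∧ not (inU U i) ∧ not (inU U j)

deg' : ∀ {n} (G : Graph n) → Subset n → EdgeSet G → Fin n → ℕ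
deg' {n} G U D v = sumFin n (λ j → if adj' G U D v j then 1 else 0)

record Solution (I : Instance) (U : Subset (n I)) (D : EdgeSet (G I)) : Set where
  field
    budget-v : + sumV (wv I) U ℤ.≤ kv I
    budget-e : + sumE (we I) D ℤ.≤ ke I
    budget-c : + (sumV (cv I) U ℕ.+ sumE (ce I) D) ℤ.≤ C I
    degrees  : ∀ v → v ∉ U → deg' (G I) U D v ≡ δ I v

data Walk' {n} (G : Graph n) (U : Subset n) (D : EdgeSet G) : Fin n → Fin n → Set where
  here : ∀ {u} → Walk' G U D u u
  step : ∀ {u m v} → adj' G U D u m ≡ true → Walk' G U D m v → Walk' G U D u v

Connected' : ∀ {n} (G : Graph n) → Subset n → EdgeSet G → Set
Connected' G U D = ∀ u v → u ∉ U → v ∉ U → Walk' G U D u v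

YesDPGGD : Instance → Set
YesDPGGD I = Σ (Subset (n I)) λ U → Σ (EdgeSet (G I)) λ D → Solution I U D

YesDCPGGD : Instance → Set
YesDCPGGD I = Σ (Subset (n I)) λ U → Σ (EdgeSet (G I)) λ D →
  Solution I U D × Connected' (G I) U D

Normalized : Instance → Set
Normalized I =
  (∀ v → δ I v ℕ.≤ deg (G I) v × + deg (G I) v ℤ.≤ + δ I v ℤ.+ kv I ℤ.+ ke I)
  × (∀ u → deg (G I) u ≡ δ I u →
       ∃ λ x → Adj (G I) u x × deg (G I) x ≢ δ I x)

Within2 : ∀ {n} → Graph n → Fin n → Fin n → Set
Within2 G x v = x ≡ v ⊎ Adj G x v ⊎ (∃ λ m → Adj G x m × Adj G m v)

TwoDominating : ∀ {n} → Graph n → Subset n → Set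
TwoDominating G X = ∀ v → ∃ λ x → x ∈ X × Within2 G x v

{-# OPTIONS --safe #-}
module Submission where

-- Take X = U ∪ V(D). A surviving vertex v with d_G(v) ≠ δ(v) must lose some
-- edge vj in G − U − D, so vj ∈ D or j ∈ U; either way v is within distance 1
-- of X (as is every v ∈ U). By condition (ii) of normalization every vertex
-- with d_G(v) = δ(v) has a neighbour of the first kind, so X is 2-dominating.
-- Positive weights give |X| ≤ |U| + 2|D| ≤ w(U) + 2w(D).

open import Defs
open import Data.Nat using (ℕ)
open import Data.Integer using (ℤ; +_; _+_; _*_; _≤_)
open import Data.Fin.Subset using (Subset; ∣_∣)
open import Data.Product using (Σ; _×_)

open import Data.Nat as ℕ using (zero; suc; z≤n; s≤s)
import Data.Nat.Properties as ℕₚ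
import Data.Integer as ℤ
import Data.Integer.Properties as ℤₚ
open import Data.Fin using (Fin; zero; suc; _<_; _<?_)
open import Data.Fin.Properties using (<-cmp; <-asym; ¬∀⟶∃¬)
open import Data.Fin.Subset using (_∈_; _∪_; outside; inside)
open import Data.Fin.Subset.Properties using (_∈?_; x∈p∪q⁺)
open import Data.Vec using ([]; _∷_; lookup; tabulate)
open import Data.Vec.Properties using (lookup⇒[]=; lookup∘tabulate; tabulate∘lookup)
open import Data.Bool using (Bool; true; false; if_then_else_; _∧_; _∨_; not)
import Data.Bool.Properties as Boolₚ
open import Data.Product using (∃; _,_)
open import Data.Sum using (_⊎_; inj₁; inj₂)
open import Function using (_∘_; flip)
open import Relation.Binary using (tri<; tri≈; tri>)
open import Relation.Unary using (Decidable)
open import Relation.Nullary using (¬_; yes; no; contradiction)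
open import Relation.Nullary.Decidable using (⌊_⌋)
open import Relation.Binary.PropositionalEquality as ≡
  using (_≡_; _≢_; refl; trans; cong; cong₂; module ≡-Reasoning)
open import Algebra.Properties.CommutativeMonoid.Sum ℕₚ.+-0-commutativeMonoid
  using (sum; ∑-distrib-+; ∑-comm)

𝟙 : Bool → ℕ
𝟙 b = if b then 1 else 0

sumFin-cong : ∀ n {f g : Fin n → ℕ} → (∀ i → f i ≡ g i) → sumFin n f ≡ sumFin n g
sumFin-cong zero    f≗g = refl
sumFin-cong (suc n) f≗g = cong₂ ℕ._+_ (f≗g zero) (sumFin-cong n (f≗g ∘ suc))

sumFin-mono : ∀ n {f g : Fin n → ℕ} → (∀ i → f i ℕ.≤ g i) → sumFin n f ℕ.≤ sumFin n g
sumFin-mono zero    f≤g = z≤n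
sumFin-mono (suc n) f≤g = ℕₚ.+-mono-≤ (f≤g zero) (sumFin-mono n (f≤g ∘ suc))

sumFin≡sum : ∀ n (f : Fin n → ℕ) → sumFin n f ≡ sum f
sumFin≡sum zero    f = refl
sumFin≡sum (suc n) f = cong (f zero ℕ.+_) (sumFin≡sum n (f ∘ suc))

sumFin-distrib-+ : ∀ n (f g : Fin n → ℕ) →
                   sumFin n (λ i → f i ℕ.+ g i) ≡ sumFin n f ℕ.+ sumFin n g
sumFin-distrib-+ n f g = begin
  sumFin n (λ i → f i ℕ.+ g i)  ≡⟨ sumFin≡sum n _ ⟩
  sum (λ i → f i ℕ.+ g i)       ≡⟨ ∑-distrib-+ f g ⟩
  sum f ℕ.+ sum g               ≡⟨ ≡.sym (cong₂ ℕ._+_ (sumFin≡sum n f) (sumFin≡sum n g)) ⟩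
  sumFin n f ℕ.+ sumFin n g     ∎
  where open ≡-Reasoning

sumFin-comm : ∀ m n (f : Fin m → Fin n → ℕ) →
              sumFin m (λ i → sumFin n (f i)) ≡ sumFin n (λ j → sumFin m (λ i → f i j))
sumFin-comm m n f = begin
  sumFin m (λ i → sumFin n (f i))  ≡⟨ sumFin²≡sum² m n f ⟩
  sum (λ i → sum (f i))            ≡⟨ ∑-comm f ⟩
  sum (λ j → sum (flip f j))       ≡⟨ ≡.sym (sumFin²≡sum² n m (flip f)) ⟩
  sumFin n (λ j → sumFin m (flip f j)) ∎
  where
  open ≡-Reasoning
  sumFin²≡sum² : ∀ m n (f : Fin m → Fin n → ℕ) →
                 sumFin m (λ i → sumFin n (f i)) ≡ sum (λ i → sum (f i))
  sumFin²≡sum² m n f = trans (sumFin-cong m (λ i → sumFin≡sum n (f i))) (sumFin≡sum m _)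

anyFin : ∀ n → (Fin n → Bool) → Bool
anyFin zero    b = false
anyFin (suc n) b = b zero ∨ anyFin n (b ∘ suc)

anyFin-intro : ∀ n (b : Fin n → Bool) j → b j ≡ true → anyFin n b ≡ true
anyFin-intro (suc n) b zero    bj rewrite bj = refl
anyFin-intro (suc n) b (suc j) bj rewrite anyFin-intro n (b ∘ suc) j bj = Boolₚ.∨-zeroʳ (b zero)

𝟙-anyFin≤sumFin : ∀ n (b : Fin n → Bool) → 𝟙 (anyFin n b) ℕ.≤ sumFin n (𝟙 ∘ b)
𝟙-anyFin≤sumFin zero    b = z≤n
𝟙-anyFin≤sumFin (suc n) b with b zero
... | true  = s≤s z≤n
... | false = 𝟙-anyFin≤sumFin n (b ∘ suc)

∣tabulate∣≡sumFin : ∀ n (b : Fin n → Bool) → ∣ tabulate b ∣ ≡ sumFin n (𝟙 ∘ b)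
∣tabulate∣≡sumFin zero    b = refl
∣tabulate∣≡sumFin (suc n) b with b zero
... | true  = cong suc (∣tabulate∣≡sumFin n (b ∘ suc))
... | false = ∣tabulate∣≡sumFin n (b ∘ suc)

∣p∣≡sumV : ∀ {n} (p : Subset n) → ∣ p ∣ ≡ sumV (λ _ → 1) p
∣p∣≡sumV p = trans (cong ∣_∣ (≡.sym (tabulate∘lookup p))) (∣tabulate∣≡sumFin _ (lookup p))

∣p∪q∣≤∣p∣+∣q∣ : ∀ {n} (p q : Subset n) → ∣ p ∪ q ∣ ℕ.≤ ∣ p ∣ ℕ.+ ∣ q ∣
∣p∪q∣≤∣p∣+∣q∣ []            []            = z≤n
∣p∪q∣≤∣p∣+∣q∣ (outside ∷ p) (outside ∷ q) = ∣p∪q∣≤∣p∣+∣q∣ p q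
∣p∪q∣≤∣p∣+∣q∣ (outside ∷ p) (inside  ∷ q) =
  ℕₚ.≤-trans (s≤s (∣p∪q∣≤∣p∣+∣q∣ p q)) (ℕₚ.≤-reflexive (≡.sym (ℕₚ.+-suc ∣ p ∣ ∣ q ∣)))
∣p∪q∣≤∣p∣+∣q∣ (inside  ∷ p) (outside ∷ q) = s≤s (∣p∪q∣≤∣p∣+∣q∣ p q)
∣p∪q∣≤∣p∣+∣q∣ (inside  ∷ p) (inside  ∷ q) =
  s≤s (ℕₚ.≤-trans (∣p∪q∣≤∣p∣+∣q∣ p q) (ℕₚ.+-monoʳ-≤ ∣ p ∣ (ℕₚ.n≤1+n ∣ q ∣)))

sumV-mono : ∀ {n} {f g : Fin n → ℕ} (U : Subset n) →
            (∀ i → f i ℕ.≤ g i) → sumV f U ℕ.≤ sumV g U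
sumV-mono {n} {f} {g} U f≤g = sumFin-mono n pointwise
  where
  pointwise : ∀ i → (if inU U i then f i else 0) ℕ.≤ (if inU U i then g i else 0)
  pointwise i with inU U i
  ... | true  = f≤g i
  ... | false = z≤n

sumE-mono : ∀ {n} {G : Graph n} {f g : Fin n → Fin n → ℕ} (D : EdgeSet G) →
            (∀ i j → i < j → Adj G i j → f i j ℕ.≤ g i j) → sumE f D ℕ.≤ sumE g D
sumE-mono {n} {G} {f} {g} D f≤g = sumFin-mono n λ i → sumFin-mono n (pointwise i)
  where
  pointwise : ∀ i j → (if ⌊ i <? j ⌋ ∧ mem D i j then f i j else 0)
                      ℕ.≤ (if ⌊ i <? j ⌋ ∧ mem D i j then g i j else 0)
  pointwise i j with i <? j | mem D i j in ij∈D
  ... | yes i<j | true  = f≤g i j i<j (sub D i j ij∈D)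
  ... | yes _   | false = z≤n
  ... | no _    | _     = z≤n

∣_∣ₑ : ∀ {n} {G : Graph n} → EdgeSet G → ℕ
∣ D ∣ₑ = sumE (λ _ _ → 1) D

endpoints : ∀ {n} {G : Graph n} → EdgeSet G → Subset n
endpoints {n} D = tabulate (λ i → anyFin n (mem D i))

module _ {n} {G : Graph n} (D : EdgeSet G) where

  mem-irrefl : ∀ i → mem D i i ≡ false
  mem-irrefl i = Boolₚ.¬-not λ ii∈D →
    contradiction (trans (≡.sym (sub D i i ii∈D)) (irrefl G i)) λ ()

  ∈endpoints : ∀ {i j} → mem D i j ≡ true → i ∈ endpoints D
  ∈endpoints {i} {j} ij∈D =
    lookup⇒[]= i (endpoints D) (trans (lookup∘tabulate _ i) (anyFin-intro n (mem D i) j ij∈D))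

  𝟙-mem≡𝟙-oriented : ∀ i j →
    𝟙 (mem D i j) ≡ 𝟙 (⌊ i <? j ⌋ ∧ mem D i j) ℕ.+ 𝟙 (⌊ j <? i ⌋ ∧ mem D j i)
  𝟙-mem≡𝟙-oriented i j with i <? j | j <? i
  ... | yes i<j | yes j<i = contradiction j<i (<-asym i<j)
  ... | yes _   | no _    = ≡.sym (ℕₚ.+-identityʳ _)
  ... | no _    | yes _   = cong 𝟙 (symm D i j)
  ... | no i≮j  | no j≮i with <-cmp i j
  ...   | tri< i<j _ _  = contradiction i<j i≮j
  ...   | tri> _ _ j<i  = contradiction j<i j≮i
  ...   | tri≈ _ refl _ = cong 𝟙 (mem-irrefl i)

  handshake : sumFin n (λ i → sumFin n (λ j → 𝟙 (mem D i j))) ≡ 2 ℕ.* ∣ D ∣ₑ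
  handshake = begin
    sumFin n (λ i → sumFin n (λ j → 𝟙 (mem D i j)))
      ≡⟨ sumFin-cong n (λ i → sumFin-cong n (𝟙-mem≡𝟙-oriented i)) ⟩
    sumFin n (λ i → sumFin n (λ j → E i j ℕ.+ E j i))
      ≡⟨ sumFin-cong n (λ i → sumFin-distrib-+ n (E i) (flip E i)) ⟩
    sumFin n (λ i → sumFin n (E i) ℕ.+ sumFin n (flip E i))
      ≡⟨ sumFin-distrib-+ n _ _ ⟩
    ∣ D ∣ₑ ℕ.+ sumFin n (λ i → sumFin n (flip E i))
      ≡⟨ cong (∣ D ∣ₑ ℕ.+_) (sumFin-comm n n (flip E)) ⟩
    ∣ D ∣ₑ ℕ.+ ∣ D ∣ₑ
      ≡⟨ cong (∣ D ∣ₑ ℕ.+_) (≡.sym (ℕₚ.+-identityʳ ∣ D ∣ₑ)) ⟩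
    2 ℕ.* ∣ D ∣ₑ ∎
    where
    open ≡-Reasoning
    E : Fin n → Fin n → ℕ
    E i j = 𝟙 (⌊ i <? j ⌋ ∧ mem D i j)

  ∣endpoints∣≤2∣D∣ : ∣ endpoints D ∣ ℕ.≤ 2 ℕ.* ∣ D ∣ₑ
  ∣endpoints∣≤2∣D∣ = begin
    ∣ endpoints D ∣
      ≡⟨ ∣tabulate∣≡sumFin n _ ⟩
    sumFin n (λ i → 𝟙 (anyFin n (mem D i)))
      ≤⟨ sumFin-mono n (λ i → 𝟙-anyFin≤sumFin n (mem D i)) ⟩
    sumFin n (λ i → sumFin n (λ j → 𝟙 (mem D i j)))
      ≡⟨ handshake ⟩
    2 ℕ.* ∣ D ∣ₑ ∎
    where open ℕₚ.≤-Reasoning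

Within1 : ∀ {n} → Graph n → Fin n → Fin n → Set
Within1 G x v = x ≡ v ⊎ Adj G x v

edge-lost : ∀ a m u w → a ≢ (a ∧ not m ∧ not u ∧ not w) →
            a ≡ true × (m ≡ true ⊎ u ≡ true ⊎ w ≡ true)
edge-lost false _     _     _     a≢a' = contradiction refl a≢a'
edge-lost true  true  _     _     _    = refl , inj₁ refl
edge-lost true  false true  _     _    = refl , inj₂ (inj₁ refl)
edge-lost true  false false true  _    = refl , inj₂ (inj₂ refl)
edge-lost true  false false false a≢a' = contradiction refl a≢a'

deg'≢deg⇒near-U∪endpoints : ∀ {n} {G : Graph n} (U : Subset n) (D : EdgeSet G) v →
  deg' G U D v ≢ deg G v → ∃ λ x → x ∈ U ∪ endpoints D × Within1 G x v
deg'≢deg⇒near-U∪endpoints {n} {G} U D v deg'≢deg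
  with j , lost ← ¬∀⟶∃¬ n (λ j → adj G v j ≡ adj' G U D v j)
                          (λ j → adj G v j Boolₚ.≟ adj' G U D v j)
                          (λ kept → deg'≢deg (≡.sym (sumFin-cong n (cong 𝟙 ∘ kept))))
  with edge-lost (adj G v j) (mem D v j) (inU U v) (inU U j) lost
... | _   , inj₁ vj∈D        = v , x∈p∪q⁺ (inj₂ (∈endpoints D vj∈D)) , inj₁ refl
... | _   , inj₂ (inj₁ v∈U)  = v , x∈p∪q⁺ (inj₁ (lookup⇒[]= v U v∈U)) , inj₁ refl
... | vj  , inj₂ (inj₂ j∈U)  =
  j , x∈p∪q⁺ (inj₁ (lookup⇒[]= j U j∈U)) , inj₂ (trans (Graph.sym G j v) vj)

near⇒twoDominating : ∀ {n} (G : Graph n) (X : Subset n) {P : Fin n → Set} → Decidable P →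
  (∀ v → ¬ P v → ∃ λ x → x ∈ X × Within1 G x v) →
  (∀ u → P u → ∃ λ y → Adj G u y × ¬ P y) →
  TwoDominating G X
near⇒twoDominating G X P? near escape v with P? v
... | no ¬Pv with near v ¬Pv
...   | x , x∈X , inj₁ x≡v = x , x∈X , inj₁ x≡v
...   | x , x∈X , inj₂ xv  = x , x∈X , inj₂ (inj₁ xv)
near⇒twoDominating G X P? near escape v | yes Pv with escape v Pv
...   | y , vy , ¬Py with near y ¬Py
...     | x , x∈X , inj₁ refl = x , x∈X , inj₂ (inj₁ (trans (Graph.sym G x v) vy))
...     | x , x∈X , inj₂ xy   = x , x∈X , inj₂ (inj₂ (y , xy , trans (Graph.sym G y v) vy))

∣U∪endpoints∣≤sumV+2sumE : ∀ {n} {G : Graph n} {f : Fin n → ℕ} {g : Fin n → Fin n → ℕ}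
  (U : Subset n) (D : EdgeSet G) →
  (∀ i → 1 ℕ.≤ f i) → (∀ i j → i < j → Adj G i j → 1 ℕ.≤ g i j) →
  ∣ U ∪ endpoints D ∣ ℕ.≤ sumV f U ℕ.+ 2 ℕ.* sumE g D
∣U∪endpoints∣≤sumV+2sumE U D f≥1 g≥1 = begin
  ∣ U ∪ endpoints D ∣
    ≤⟨ ∣p∪q∣≤∣p∣+∣q∣ U (endpoints D) ⟩
  ∣ U ∣ ℕ.+ ∣ endpoints D ∣
    ≤⟨ ℕₚ.+-mono-≤ (ℕₚ.≤-reflexive (∣p∣≡sumV U)) (∣endpoints∣≤2∣D∣ D) ⟩
  sumV (λ _ → 1) U ℕ.+ 2 ℕ.* ∣ D ∣ₑ
    ≤⟨ ℕₚ.+-mono-≤ (sumV-mono U f≥1) (ℕₚ.*-monoʳ-≤ 2 (sumE-mono D g≥1)) ⟩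
  sumV _ U ℕ.+ 2 ℕ.* sumE _ D ∎
  where open ℕₚ.≤-Reasoning

+-mono-≤-2* : ∀ {a b} {k l : ℤ} → + a ≤ k → + b ≤ l → + (a ℕ.+ 2 ℕ.* b) ≤ k + + 2 * l
+-mono-≤-2* {a} {b} {k} {l} a≤k b≤l = begin
  + (a ℕ.+ 2 ℕ.* b)    ≡⟨ ℤₚ.pos-+ a (2 ℕ.* b) ⟩
  + a + + (2 ℕ.* b)    ≡⟨ cong (_+_ (+ a)) (ℤₚ.pos-* 2 b) ⟩
  + a + + 2 * + b      ≤⟨ ℤₚ.+-mono-≤ a≤k (ℤₚ.*-monoˡ-≤-nonNeg (+ 2) b≤l) ⟩
  k + + 2 * l          ∎
  where open ℤₚ.≤-Reasoning

unbalanced⇒near-U∪endpoints : ∀ {I U D} → Solution I U D →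
  ∀ v → deg (G I) v ≢ δ I v → ∃ λ x → x ∈ U ∪ endpoints D × Within1 (G I) x v
unbalanced⇒near-U∪endpoints {U = U} {D} sol v deg≢δ with v ∈? U
... | yes v∈U = v , x∈p∪q⁺ (inj₁ v∈U) , inj₁ refl
... | no  v∉U = deg'≢deg⇒near-U∪endpoints U D v
                  (λ deg'≡deg → deg≢δ (trans (≡.sym deg'≡deg) (Solution.degrees sol v v∉U)))

lemma4 : ((I : Instance) → Normalized I → YesDPGGD I →
              Σ (Subset (n I)) λ X → TwoDominating (G I) X × + ∣ X ∣ ≤ kv I + + 2 * ke I)
         × ((I : Instance) → Normalized I → YesDCPGGD I →
              Σ (Subset (n I)) λ X → TwoDominating (G I) X × + ∣ X ∣ ≤ kv I + + 2 * ke I)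
lemma4 = twoDominatingSet , λ { I normal (U , D , sol , _) →
                                  twoDominatingSet I normal (U , D , sol) }
  where
  twoDominatingSet : (I : Instance) → Normalized I → YesDPGGD I →
    Σ (Subset (n I)) λ X → TwoDominating (G I) X × + ∣ X ∣ ≤ kv I + + 2 * ke I
  twoDominatingSet I (_ , escape) (U , D , sol) =
    U ∪ endpoints D ,
    near⇒twoDominating (G I) _ (λ v → deg (G I) v ℕ.≟ δ I v)
                       (unbalanced⇒near-U∪endpoints sol) escape ,
    ℤₚ.≤-trans (ℤ.+≤+ (∣U∪endpoints∣≤sumV+2sumE U D (wv-pos I) (we-pos I)))
               (+-mono-≤-2* (Solution.budget-v sol) (Solution.budget-e sol))
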